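{- Let $R$ be a simple graph on vertex set $V$ and $B$ its complement on $V$. Let $W\subseteq V$. If $B[W]$ is a disjoint union of paths and the components of $B[W]$ can be partitioned into two groups whose vertex sets $X$ and $Y$ satisfy $|X|=a$ and $|Y|=b$ for some integers $3\le a\le b\le 2a$, then $R[W]$ has a non-trivial good orientation.
   Context: $R[W]$, $B[W]$ denote induced subgraphs. An orientation $O_W$ of $R[W]$ is good if there is a partition of $W$ into two sets $U_1,V_1$ such that $d_{O_W}(x,y)\le 2$ (directed distance) whenever $x,y$ are both in $U_1$ or both in $V_1$; it is non-trivial good if moreover every vertex of $U_1$ has an in-neighbor and an out-neighbor in $V_1$ and every vertex of $V_1$ has an in-neighbor and an out-neighbor in $U_1$. -}

module Defs where

open import Data.Nat using (ℕ)
open import Data.Fin using (Fin)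
open import Data.Fin.Subset using (Subset; _∈_; _∉_)
open import Data.Bool using (Bool; true; false; T)
open import Data.List using (List; []; _∷_; concat)
import Data.List.Membership.Propositional as LM
open import Data.List.Relation.Unary.Unique.Propositional using (Unique)
open import Data.Product using (Σ; ∃; _×_; _,_)
open import Data.Sum using (_⊎_)
open import Relation.Binary.PropositionalEquality using (_≡_; _≢_)
open import Relation.Nullary using (¬_)
open import Function.Bundles using (_⇔_)

record SimpleGraph (n : ℕ) : Set where
  field
    adj    : Fin n → Fin n → Bool
    sym    : ∀ x y → adj x y ≡ adj y x
    irrefl : ∀ x → adj x x ≡ false

open SimpleGraph public

Edge : ∀ {n} → SimpleGraph n → Fin n → Fin n → Set
Edge R x y = T (adj R x y)

CoEdge : ∀ {n} → SimpleGraph n → Fin n → Fin n → Set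
CoEdge R x y = x ≢ y × ¬ Edge R x y

data Consec {A : Set} : List A → A → A → Set where
  here  : ∀ {x y xs} → Consec (x ∷ y ∷ xs) x y
  there : ∀ {z xs x y} → Consec xs x y → Consec (z ∷ xs) x y

-- ps is a list of (nonempty, vertex-disjoint) paths, given as vertex sequences,
-- such that B[W] is exactly their disjoint union: the vertices are exactly W and
-- the edges of B[W] are exactly the consecutive pairs on the paths.
-- Hence the components of B[W] are exactly the paths in ps.
IsPathDecomposition : ∀ {n} → SimpleGraph n → Subset n → List (List (Fin n)) → Set
IsPathDecomposition {n} R W ps =
  (∀ {p} → p LM.∈ ps → p ≢ [])
  × Unique (concat ps)
  × (∀ (x : Fin n) → (x ∈ W) ⇔ (x LM.∈ concat ps))
  × (∀ (x y : Fin n) → x ∈ W → y ∈ W →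
       CoEdge R x y ⇔ (Σ (List (Fin n)) λ p → p LM.∈ ps × (Consec p x y ⊎ Consec p y x)))

Arc : ∀ {n} → (Fin n → Fin n → Bool) → Fin n → Fin n → Set
Arc O x y = T (O x y)

IsOrientation : ∀ {n} → SimpleGraph n → Subset n → (Fin n → Fin n → Bool) → Set
IsOrientation {n} R W O =
  (∀ (x y : Fin n) → Arc O x y → x ∈ W × y ∈ W × Edge R x y)
  × (∀ (x y : Fin n) → x ∈ W → y ∈ W → Edge R x y →
       (Arc O x y × ¬ Arc O y x) ⊎ (Arc O y x × ¬ Arc O x y))

Dist≤2 : ∀ {n} → (Fin n → Fin n → Bool) → Fin n → Fin n → Set
Dist≤2 {n} O x y = x ≡ y ⊎ Arc O x y ⊎ (Σ (Fin n) λ z → Arc O x z × Arc O z y)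

IsPartition : ∀ {n} → Subset n → Subset n → Subset n → Set
IsPartition {n} W U₁ V₁ =
  ∀ (x : Fin n) → (x ∈ W ⇔ (x ∈ U₁ ⊎ x ∈ V₁)) × ¬ (x ∈ U₁ × x ∈ V₁)

NonTrivialGood : ∀ {n} → SimpleGraph n → Subset n → (Fin n → Fin n → Bool) → Set
NonTrivialGood {n} R W O =
  IsOrientation R W O
  × Σ (Subset n) λ U₁ → Σ (Subset n) λ V₁ →
      IsPartition W U₁ V₁
      × (∀ x y → x ∈ U₁ → y ∈ U₁ → Dist≤2 O x y)
      × (∀ x y → x ∈ V₁ → y ∈ V₁ → Dist≤2 O x y)
      × (∀ u → u ∈ U₁ → (Σ (Fin n) λ v → v ∈ V₁ × Arc O v u)
                       × (Σ (Fin n) λ v → v ∈ V₁ × Arc O u v))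
      × (∀ v → v ∈ V₁ → (Σ (Fin n) λ u → u ∈ U₁ × Arc O u v)
                       × (Σ (Fin n) λ u → u ∈ U₁ × Arc O v u))

HasNonTrivialGoodOrientation : ∀ {n} → SimpleGraph n → Subset n → Set
HasNonTrivialGoodOrientation {n} R W = Σ (Fin n → Fin n → Bool) λ O → NonTrivialGood R W O

module Submission where

-- Listing the paths of B[W] one after another enumerates W as w₀, …, w_{N−1} (N = a + b) so that
-- every edge of B[W] joins consecutive entries. Hence R[W] contains the complement of the path
-- w₀ − w₁ − ⋯ − w_{N−1}, and a non-trivial good orientation of that complement, extended to the
-- other edges of R[W] by the same tournament on positions, is one of R[W]. For N ≥ 8 let
-- m = ⌊N/2⌋, orient i < j as i → j iff j − i ≤ m, and take the two parity classes: positions of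
-- equal parity differ by at least 2 and are joined within two arcs both ways (halving a long
-- forward gap, detouring around a short backward one), while a step of 3 or an odd jump beyond m
-- reaches the other class. N = 6, 7 are settled by computation.

open import Defs hiding (sym)
open import Data.Bool using (Bool; true; false; T; not; if_then_else_)
open import Data.Bool.Properties using (T?; T-≡; not-involutive)
open import Data.Empty using (⊥-elim)
open import Data.Fin using (Fin) renaming (_≟_ to _≟ᶠ_)
open import Data.Fin.Subset using (Subset; _∈_)
open import Data.Fin.Subset.Properties using (_∈?_)
open import Data.List using (List; []; _∷_; _++_; concat; length)
open import Data.List.Properties using (length-++; concat-++)
open import Data.List.Membership.Propositional using () renaming (_∈_ to _∈ₗ_)
open import Data.List.Relation.Unary.Any using (here; there)
import Data.List.Relation.Unary.All as All
open import Data.List.Relation.Unary.AllPairs using (_∷_)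
open import Data.List.Relation.Unary.Unique.Propositional using (Unique)
open import Data.Nat
open import Data.Nat.Properties
open import Data.Nat.Tactic.RingSolver using (solve-∀)
open import Data.Parity.Base using (Parity; 0ℙ; 1ℙ; _⁻¹) renaming (_+_ to _ℙ+_)
import Data.Parity.Properties as ℙ
open import Data.Product using (Σ; ∃; ∃₂; _×_; _,_; proj₁; proj₂)
open import Data.Sum using (_⊎_; inj₁; inj₂; [_,_])
open import Data.Unit using (tt)
open import Data.Vec using (tabulate)
open import Data.Vec.Properties using (lookup∘tabulate; []=⇒lookup; lookup⇒[]=)
open import Function using (_∘_)
open import Function.Bundles using (_⇔_; Equivalence; mk⇔)
open import Relation.Binary.Definitions using (tri<; tri≈; tri>)
open import Relation.Binary.PropositionalEquality
  using (_≡_; _≢_; refl; sym; trans; cong; cong₂; subst; ≢-sym; module ≡-Reasoning)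
open import Relation.Nullary using (¬_; Dec; yes; no)
open import Relation.Nullary.Decidable
  using (⌊_⌋; toWitness; fromWitness; _×-dec_; _⊎-dec_; _→-dec_; ¬?)

-- Good orientations of the complement of a path

Far : ℕ → ℕ → Set
Far i j = 2 + i ≤ j ⊎ 2 + j ≤ i

Far-sym : ∀ {i j} → Far i j → Far j i
Far-sym (inj₁ p) = inj₂ p
Far-sym (inj₂ p) = inj₁ p

¬Far-refl : ∀ i → ¬ Far i i
¬Far-refl i (inj₁ p) = <-irrefl refl (<⇒≤ p)
¬Far-refl i (inj₂ p) = <-irrefl refl (<⇒≤ p)

¬Far-suc : ∀ i → ¬ Far i (suc i)
¬Far-suc i (inj₁ p) = <-irrefl refl (s≤s⁻¹ p)
¬Far-suc i (inj₂ p) = <-irrefl refl (<⇒≤ (<⇒≤ p))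

T-not : ∀ {b} → ¬ T b → T (not b)
T-not {false} _  = tt
T-not {true}  ¬t = ¬t tt

tournament : (ℕ → ℕ → Bool) → ℕ → ℕ → Bool
tournament g i j = if i <ᵇ j then g i j else not (g j i)

tournament-< : ∀ g {i j} → i < j → tournament g i j ≡ g i j
tournament-< g {i} {j} i<j with i <ᵇ j | <⇒<ᵇ i<j
... | true | _ = refl

tournament-> : ∀ g {i j} → j < i → tournament g i j ≡ not (g j i)
tournament-> g {i} {j} j<i with i <ᵇ j in eq
... | true  = ⊥-elim (<-asym j<i (<ᵇ⇒< i j (subst T (sym eq) tt)))
... | false = refl

tournament-antisym : ∀ g {i j} → i ≢ j → tournament g j i ≡ not (tournament g i j)
tournament-antisym g {i} {j} i≢j with <-cmp i j
... | tri< i<j _ _ = trans (tournament-> g i<j) (cong not (sym (tournament-< g i<j)))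
... | tri≈ _ i≡j _ = ⊥-elim (i≢j i≡j)
... | tri> _ _ j<i =
  trans (tournament-< g j<i) (trans (sym (not-involutive _)) (cong not (sym (tournament-> g j<i))))

tournament-total : ∀ g {i j} → i ≢ j → T (tournament g i j) ⊎ T (tournament g j i)
tournament-total g {i} {j} i≢j with tournament g i j | tournament-antisym g i≢j
... | true  | _        = inj₁ tt
... | false | j→i≡true = inj₂ (subst T (sym j→i≡true) tt)

tournament-asym : ∀ g {i j} → i ≢ j → T (tournament g i j) → ¬ T (tournament g j i)
tournament-asym g {i} {j} i≢j with tournament g i j | tournament-antisym g i≢j
... | true  | j→i≡false = λ _ j→i → subst T j→i≡false j→i
... | false | _         = λ ()

FarArc : (ℕ → ℕ → Bool) → ℕ → ℕ → Set
FarArc g i j = T (tournament g i j) × Far i j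

Reach≤2 : (ℕ → ℕ → Bool) → ℕ → ℕ → ℕ → Set
Reach≤2 g N i j = i ≡ j ⊎ FarArc g i j ⊎ ∃ λ k → k < N × FarArc g i k × FarArc g k j

record GoodCoPath (N : ℕ) (g : ℕ → ℕ → Bool) (part : ℕ → Parity) : Set where
  field
    close      : ∀ {i} → i < N → ∀ {j} → j < N → part i ≡ part j → Reach≤2 g N i j
    in-across  : ∀ {i} → i < N → ∃ λ k → k < N × part k ≢ part i × FarArc g k i
    out-across : ∀ {i} → i < N → ∃ λ k → k < N × part k ≢ part i × FarArc g i k

farArc? : ∀ g i j → Dec (FarArc g i j)
farArc? g i j = T? (tournament g i j) ×-dec (2 + i ≤? j ⊎-dec 2 + j ≤? i)

reach≤2? : ∀ g N i j → Dec (Reach≤2 g N i j)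
reach≤2? g N i j =
  i ≟ j ⊎-dec farArc? g i j ⊎-dec anyUpTo? (λ k → farArc? g i k ×-dec farArc? g k j) N

module _ (N : ℕ) (g : ℕ → ℕ → Bool) (part : ℕ → Parity) where
  private
    close? : ∀ i → Dec (∀ {j} → j < N → part i ≡ part j → Reach≤2 g N i j)
    close? i = allUpTo? (λ j → part i ℙ.≟ part j →-dec reach≤2? g N i j) N

    in-across? : ∀ i → Dec (∃ λ k → k < N × part k ≢ part i × FarArc g k i)
    in-across? i = anyUpTo? (λ k → ¬? (part k ℙ.≟ part i) ×-dec farArc? g k i) N

    out-across? : ∀ i → Dec (∃ λ k → k < N × part k ≢ part i × FarArc g i k)
    out-across? i = anyUpTo? (λ k → ¬? (part k ℙ.≟ part i) ×-dec farArc? g i k) N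

  goodCoPath? : Dec (GoodCoPath N g part)
  goodCoPath? with allUpTo? close? N ×-dec allUpTo? in-across? N ×-dec allUpTo? out-across? N
  ... | yes (c , inn , out) = yes record { close = c ; in-across = inn ; out-across = out }
  ... | no ¬good = no λ good → let open GoodCoPath good in ¬good (close , in-across , out-across)

-- ⌊ N /2⌋ < 4 here, too small for the parity construction below.
g₆ : ℕ → ℕ → Bool
g₆ 0 4 = true
g₆ 0 5 = true
g₆ 1 3 = true
g₆ 1 5 = true
g₆ 2 4 = true
g₆ _ _ = false

part₆ : ℕ → Parity
part₆ 0 = 0ℙ
part₆ 1 = 0ℙ
part₆ 2 = 0ℙ
part₆ _ = 1ℙ

g₇ : ℕ → ℕ → Bool
g₇ 0 2 = true
g₇ 0 6 = true
g₇ 1 4 = true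
g₇ 1 6 = true
g₇ 2 5 = true
g₇ _ _ = false

part₇ : ℕ → Parity
part₇ 1 = 1ℙ
part₇ 2 = 1ℙ
part₇ 3 = 1ℙ
part₇ _ = 0ℙ

goodCoPath₆ : GoodCoPath 6 g₆ part₆
goodCoPath₆ = toWitness {a? = goodCoPath? 6 g₆ part₆} _

goodCoPath₇ : GoodCoPath 7 g₇ part₇
goodCoPath₇ = toWitness {a? = goodCoPath? 7 g₇ part₇} _

parity-odd+ : ∀ o n → parity o ≡ 1ℙ → parity (o + n) ≢ parity n
parity-odd+ o n odd same = ℙ.p≢p⁻¹ (parity n) (begin
  parity n              ≡⟨ sym same ⟩
  parity (o + n)        ≡⟨ ℙ.+-homo-+ o n ⟩
  parity o ℙ+ parity n  ≡⟨ cong (_ℙ+ parity n) odd ⟩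
  parity n ⁻¹           ∎)
  where open ≡-Reasoning

odd-above : ∀ m → 4 ≤ m → ∃ λ o → m < o × o + 3 ≤ m + m × parity o ≡ 1ℙ
odd-above m 4≤m with parity m in even-or-odd
... | 0ℙ = suc m , ≤-refl , ≤-trans (≤-reflexive (+-comm (suc m) 3)) (+-monoˡ-≤ m 4≤m)
         , trans (ℙ.+-homo-+ 1 m) (cong (1ℙ ℙ+_) even-or-odd)
... | 1ℙ with m≤n⇒m<n∨m≡n 4≤m
...   | inj₁ 5≤m = 2 + m , n≤1+n (suc m) , ≤-trans (≤-reflexive (+-comm (2 + m) 3)) (+-monoˡ-≤ m 5≤m)
                 , even-or-odd
...   | inj₂ refl with () ← even-or-odd

-- A gap e for a detour y → y + e → x or y → x − e → x when y − x = d ≤ m; the last bound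
-- guarantees that one of the two detours stays inside [0, N) for every N ≥ m + m.
detour-gap : ∀ {m d} → 4 ≤ m → 2 ≤ d → d ≤ m →
             ∃ λ e → 2 ≤ e × e ≤ m × m < e + d × e + (d + e) ≤ m + m
detour-gap {m} {d} 4≤m 2≤d d≤m with m ≤? suc d
... | yes m≤1+d = 2 , ≤-refl , ≤-trans (m≤n+m 2 2) 4≤m , s≤s m≤1+d
                , ≤-trans (≤-reflexive (rearrange d)) (+-mono-≤ d≤m 4≤m)
  where
  rearrange : ∀ d → 2 + (d + 2) ≡ d + 4
  rearrange = solve-∀
... | no m≰1+d with m≤n⇒∃[o]m+o≡n (≰⇒> m≰1+d)
...   | t , refl = 3 + t , s≤s (s≤s z≤n) , s≤s (s≤s (+-monoˡ-≤ t (<⇒≤ 2≤d)))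
                 , s≤s (s≤s (s≤s (≤-reflexive (+-comm d t))))
                 , ≤-trans (≤-reflexive (lhs d t))
                     (≤-trans (+-monoʳ-≤ 4 (+-monoˡ-≤ (t + t) (+-monoˡ-≤ d 2≤d)))
                              (≤-reflexive (rhs d t)))
  where
  lhs : ∀ d t → 3 + t + (d + (3 + t)) ≡ 4 + (2 + d + (t + t))
  lhs = solve-∀
  rhs : ∀ d t → 4 + (d + d + (t + t)) ≡ 2 + d + t + (2 + d + t)
  rhs = solve-∀

⌈n+n/2⌉≡n : ∀ n → ⌈ n + n /2⌉ ≡ n
⌈n+n/2⌉≡n zero    = refl
⌈n+n/2⌉≡n (suc n) = cong suc (trans (cong ⌊_/2⌋ (+-suc n n)) (⌈n+n/2⌉≡n n))

⌊n/2⌋+⌊n/2⌋≤n : ∀ n → ⌊ n /2⌋ + ⌊ n /2⌋ ≤ n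
⌊n/2⌋+⌊n/2⌋≤n n =
  ≤-trans (+-monoʳ-≤ ⌊ n /2⌋ (⌊n/2⌋≤⌈n/2⌉ n)) (≤-reflexive (⌊n/2⌋+⌈n/2⌉≡n n))

n≤1+⌊n/2⌋+⌊n/2⌋ : ∀ n → n ≤ suc (⌊ n /2⌋ + ⌊ n /2⌋)
n≤1+⌊n/2⌋+⌊n/2⌋ zero          = z≤n
n≤1+⌊n/2⌋+⌊n/2⌋ (suc zero)    = s≤s z≤n
n≤1+⌊n/2⌋+⌊n/2⌋ (suc (suc n)) =
  s≤s (≤-trans (s≤s (n≤1+⌊n/2⌋+⌊n/2⌋ n))
               (≤-reflexive (sym (cong suc (+-suc ⌊ n /2⌋ ⌊ n /2⌋)))))

-- The parity construction

module ParityConstruction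
  (m N : ℕ) (4≤m : 4 ≤ m) (m+m≤N : m + m ≤ N) (N≤1+m+m : N ≤ suc (m + m)) where

  g : ℕ → ℕ → Bool
  g i j = j ∸ i ≤ᵇ m

  2≤m : 2 ≤ m
  2≤m = ≤-trans (m≤n+m 2 2) 4≤m

  3≤m : 3 ≤ m
  3≤m = ≤-trans (n≤1+n 3) 4≤m

  forward : ∀ {d} i → 2 ≤ d → d ≤ m → FarArc g i (d + i)
  forward {d} i 2≤d d≤m =
    subst T (sym (tournament-< g (m<n+m i (<⇒≤ 2≤d)))) short , inj₁ (+-monoˡ-≤ i 2≤d)
    where
    short : T (d + i ∸ i ≤ᵇ m)
    short = subst (λ k → T (k ≤ᵇ m)) (sym (m+n∸n≡m d i)) (≤⇒≤ᵇ d≤m)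

  backward : ∀ {d} i → m < d → FarArc g (d + i) i
  backward {d} i m<d =
    subst T (sym (tournament-> g (m<n+m i (<⇒≤ 2≤d)))) long , inj₂ (+-monoˡ-≤ i 2≤d)
    where
    2≤d : 2 ≤ d
    2≤d = ≤-trans 2≤m (<⇒≤ m<d)
    long : T (not (d + i ∸ i ≤ᵇ m))
    long = subst (λ k → T (not (k ≤ᵇ m))) (sym (m+n∸n≡m d i)) (T-not (<⇒≱ m<d ∘ ≤ᵇ⇒≤ d m))

  reach-forward : ∀ {d} x → 2 ≤ d → d + x < N → Reach≤2 g N x (d + x)
  reach-forward {d} x 2≤d d+x<N with d ≤? m
  ... | yes d≤m = inj₂ (inj₁ (forward x 2≤d d≤m))
  ... | no d≰m  = inj₂ (inj₂ (h + x , ≤-<-trans (+-monoˡ-≤ x (⌊n/2⌋≤n d)) d+x<N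
                             , forward x 2≤h h≤m
                             , subst (FarArc g (h + x)) halves (forward (h + x) 2≤h′ h′≤m)))
    where
    h h′ : ℕ
    h = ⌊ d /2⌋
    h′ = ⌈ d /2⌉
    2≤h : 2 ≤ h
    2≤h = ⌊n/2⌋-mono (≤-trans (s≤s 4≤m) (≰⇒> d≰m))
    2≤h′ : 2 ≤ h′
    2≤h′ = ≤-trans 2≤h (⌊n/2⌋≤⌈n/2⌉ d)
    h′≤m : h′ ≤ m
    h′≤m = ≤-trans (⌈n/2⌉-mono (s≤s⁻¹ (≤-trans (s≤s (m≤m+n d x)) (≤-trans d+x<N N≤1+m+m))))
                   (≤-reflexive (⌈n+n/2⌉≡n m))
    h≤m : h ≤ m
    h≤m = ≤-trans (⌊n/2⌋≤⌈n/2⌉ d) h′≤m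
    halves : h′ + (h + x) ≡ d + x
    halves = trans (sym (+-assoc h′ h x)) (cong (_+ x) (trans (+-comm h′ h) (⌊n/2⌋+⌈n/2⌉≡n d)))

  detour-above : ∀ {d e} x → 2 ≤ e → e ≤ m → m < e + d →
                 e + (d + x) < N → Reach≤2 g N (d + x) x
  detour-above {d} {e} x 2≤e e≤m m<e+d above<N =
    inj₂ (inj₂ (e + (d + x) , above<N , forward (d + x) 2≤e e≤m
               , subst (λ y → FarArc g y x) (+-assoc e d x) (backward x m<e+d)))

  detour-below : ∀ {d e} x → 2 ≤ e → e ≤ m → m < e + d →
                 e ≤ x → d + x < N → Reach≤2 g N (d + x) x
  detour-below {d} {e} x 2≤e e≤m m<e+d e≤x d+x<N with m≤n⇒∃[o]m+o≡n e≤x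
  ... | k , refl =
    inj₂ (inj₂ (k , ≤-<-trans (m≤n+m k (d + e)) (subst (_< N) (sym (+-assoc d e k)) d+x<N)
               , subst (λ y → FarArc g y k) (+-assoc d e k)
                       (backward k (subst (m <_) (+-comm e d) m<e+d))
               , forward k 2≤e e≤m))

  reach-backward : ∀ {d} x → 2 ≤ d → d + x < N → Reach≤2 g N (d + x) x
  reach-backward {d} x 2≤d d+x<N with m <? d
  ... | yes m<d = inj₂ (inj₁ (backward x m<d))
  ... | no m≮d with detour-gap 4≤m 2≤d (≮⇒≥ m≮d)
  ...   | e , 2≤e , e≤m , m<e+d , e+d+e≤m+m with e + (d + x) <? N
  ...     | yes above<N = detour-above x 2≤e e≤m m<e+d above<N
  ...     | no above≮N  = detour-below x 2≤e e≤m m<e+d e≤x d+x<N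
    where
    e≤x : e ≤ x
    e≤x = +-cancelˡ-≤ d _ _ (+-cancelˡ-≤ e _ _ (≤-trans e+d+e≤m+m (≤-trans m+m≤N (≮⇒≥ above≮N))))

  same-parity-gap : ∀ {i j} → i < j → parity i ≡ parity j → ∃ λ d → 2 ≤ d × d + i ≡ j
  same-parity-gap {i} i<j same with m≤n⇒∃[o]m+o≡n (<⇒≤ i<j)
  ... | zero , refl = ⊥-elim (<-irrefl (sym (+-identityʳ i)) i<j)
  ... | suc zero , refl = ⊥-elim (parity-odd+ 1 i refl (trans (cong parity (+-comm 1 i)) (sym same)))
  ... | suc (suc t) , refl = 2 + t , s≤s (s≤s z≤n) , +-comm (2 + t) i

  close : ∀ {i} → i < N → ∀ {j} → j < N → parity i ≡ parity j → Reach≤2 g N i j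
  close {i} i<N {j} j<N same with <-cmp i j
  ... | tri≈ _ i≡j _ = inj₁ i≡j
  ... | tri< i<j _ _ with same-parity-gap i<j same
  ...   | d , 2≤d , refl = reach-forward i 2≤d j<N
  close {i} i<N {j} j<N same | tri> _ _ j<i with same-parity-gap j<i (sym same)
  ...   | d , 2≤d , refl = reach-backward j 2≤d i<N

  module Across {o} (m<o : m < o) (o+3≤m+m : o + 3 ≤ m + m) (odd : parity o ≡ 1ℙ) where

    out-across : ∀ {x} → x < N → ∃ λ k → k < N × parity k ≢ parity x × FarArc g x k
    out-across {x} x<N with 3 + x <? N
    ... | yes 3+x<N = 3 + x , 3+x<N , parity-odd+ 3 x refl , forward x (s≤s (s≤s z≤n)) 3≤m
    ... | no 3+x≮N with m≤n⇒∃[o]m+o≡n o≤x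
      where
      o≤x : o ≤ x
      o≤x = +-cancelʳ-≤ 3 o x
              (≤-trans o+3≤m+m (≤-trans m+m≤N (≤-trans (≮⇒≥ 3+x≮N) (≤-reflexive (+-comm 3 x)))))
    ...   | z , refl = z , ≤-<-trans (m≤n+m z o) x<N , ≢-sym (parity-odd+ o z odd) , backward z m<o

    in-across : ∀ {x} → x < N → ∃ λ k → k < N × parity k ≢ parity x × FarArc g k x
    in-across {x} x<N with 3 ≤? x
    ... | yes 3≤x with m≤n⇒∃[o]m+o≡n 3≤x
    ...   | z , refl = z , ≤-<-trans (m≤n+m z 3) x<N , ≢-sym (parity-odd+ 3 z refl)
                       , forward z (s≤s (s≤s z≤n)) 3≤m
    in-across {x} x<N | no 3≰x = o + x , o+x<N , parity-odd+ o x odd , backward x m<o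
      where
      o+x<N : o + x < N
      o+x<N = ≤-trans (≤-reflexive (sym (+-suc o x)))
                (≤-trans (+-monoʳ-≤ o (≰⇒> 3≰x)) (≤-trans o+3≤m+m m+m≤N))

  good : GoodCoPath N g parity
  good with odd-above m 4≤m
  ... | o , m<o , o+3≤m+m , odd =
    record { close = close ; in-across = in-across ; out-across = out-across }
    where open Across m<o o+3≤m+m odd

goodCoPath : ∀ N → 6 ≤ N → ∃₂ λ g part → GoodCoPath N g part
goodCoPath 6 _ = g₆ , part₆ , goodCoPath₆
goodCoPath 7 _ = g₇ , part₇ , goodCoPath₇
goodCoPath N@(2+ (2+ (2+ (2+ k)))) _ =
  _ , _ , ParityConstruction.good ⌊ N /2⌋ N
            (⌊n/2⌋-mono (m≤m+n 8 k)) (⌊n/2⌋+⌊n/2⌋≤n N) (n≤1+⌊n/2⌋+⌊n/2⌋ N)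
goodCoPath 1 (s≤s ())
goodCoPath 2 (s≤s (s≤s ()))
goodCoPath 3 (s≤s (s≤s (s≤s ())))
goodCoPath 4 (s≤s (s≤s (s≤s (s≤s ()))))
goodCoPath 5 (s≤s (s≤s (s≤s (s≤s (s≤s ())))))

-- From positions to R[W]

module _ {n : ℕ} where

  position : List (Fin n) → Fin n → ℕ
  position []       x = 0
  position (z ∷ zs) x with z ≟ᶠ x
  ... | yes _ = 0
  ... | no  _ = suc (position zs x)

  position-head : ∀ z zs → position (z ∷ zs) z ≡ 0
  position-head z zs with z ≟ᶠ z
  ... | yes _  = refl
  ... | no z≢z = ⊥-elim (z≢z refl)

  position-tail : ∀ {z x} zs → z ≢ x → position (z ∷ zs) x ≡ suc (position zs x)
  position-tail {z} {x} zs z≢x with z ≟ᶠ x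
  ... | yes z≡x = ⊥-elim (z≢x z≡x)
  ... | no  _   = refl

  position-< : ∀ {L x} → x ∈ₗ L → position L x < length L
  position-< {z ∷ zs} {x} x∈L with z ≟ᶠ x | x∈L
  ... | yes _  | _          = s≤s z≤n
  ... | no z≢x | here x≡z   = ⊥-elim (z≢x (sym x≡z))
  ... | no _   | there x∈zs = s≤s (position-< x∈zs)

  position-injective : ∀ {L x y} → x ∈ₗ L → y ∈ₗ L → position L x ≡ position L y → x ≡ y
  position-injective {z ∷ zs} {x} {y} x∈L y∈L same with z ≟ᶠ x | z ≟ᶠ y | x∈L | y∈L
  ... | yes z≡x | yes z≡y | _          | _          = trans (sym z≡x) z≡y
  ... | no z≢x  | _       | here x≡z   | _          = ⊥-elim (z≢x (sym x≡z))
  ... | _       | no z≢y  | _          | here y≡z   = ⊥-elim (z≢y (sym y≡z))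
  ... | no _    | no _    | there x∈zs | there y∈zs =
    position-injective x∈zs y∈zs (suc-injective same)

  position-surjective : ∀ {L} → Unique L →
                        ∀ {i} → i < length L → ∃ λ x → x ∈ₗ L × position L x ≡ i
  position-surjective {z ∷ zs} _ {zero} _ = z , here refl , position-head z zs
  position-surjective {z ∷ zs} (z∉zs ∷ unique) {suc i} (s≤s i<) with position-surjective unique i<
  ... | x , x∈zs , refl = x , there x∈zs , position-tail zs (All.lookup z∉zs x∈zs)

consec-∈ : ∀ {A : Set} {L : List A} {x y} → Consec L x y → x ∈ₗ L × y ∈ₗ L
consec-∈ here      = here refl , there (here refl)
consec-∈ (there c) = there (proj₁ (consec-∈ c)) , there (proj₂ (consec-∈ c))

consec-++ˡ : ∀ {A : Set} {p : List A} q {x y} → Consec p x y → Consec (p ++ q) x y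
consec-++ˡ q here      = here
consec-++ˡ q (there c) = there (consec-++ˡ q c)

consec-++ʳ : ∀ {A : Set} (p : List A) {q x y} → Consec q x y → Consec (p ++ q) x y
consec-++ʳ []      c = c
consec-++ʳ (z ∷ p) c = there (consec-++ʳ p c)

consec-concat : ∀ {A : Set} {ps : List (List A)} {p x y} →
                p ∈ₗ ps → Consec p x y → Consec (concat ps) x y
consec-concat {ps = p ∷ ps} (here refl) c = consec-++ˡ (concat ps) c
consec-concat {ps = p ∷ ps} (there p∈ps) c = consec-++ʳ p (consec-concat p∈ps c)

position-consec : ∀ {n} {L : List (Fin n)} {x y} →
                  Unique L → Consec L x y → position L y ≡ suc (position L x)
position-consec {L = x ∷ y ∷ _} (x∉ ∷ _) here = begin
  position (x ∷ y ∷ _) y       ≡⟨ position-tail _ (All.lookup x∉ (here refl)) ⟩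
  suc (position (y ∷ _) y)     ≡⟨ cong suc (position-head y _) ⟩
  1                            ≡⟨ cong suc (sym (position-head x _)) ⟩
  suc (position (x ∷ y ∷ _) x) ∎
  where open ≡-Reasoning
position-consec {L = z ∷ L} (z∉ ∷ unique) (there c) = begin
  position (z ∷ L) _       ≡⟨ position-tail L (All.lookup z∉ (proj₂ (consec-∈ c))) ⟩
  suc (position L _)       ≡⟨ cong suc (position-consec unique c) ⟩
  suc (suc (position L _)) ≡⟨ cong suc (sym (position-tail L (All.lookup z∉ (proj₁ (consec-∈ c))))) ⟩
  suc (position (z ∷ L) _) ∎
  where open ≡-Reasoning

∈-tabulate : ∀ {n} (f : Fin n → Bool) x → x ∈ tabulate f ⇔ T (f x)
∈-tabulate f x = mk⇔
  (λ x∈ → Equivalence.from T-≡ (trans (sym (lookup∘tabulate f x)) ([]=⇒lookup x∈)))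
  (λ fx → lookup⇒[]= x (tabulate f) (trans (lookup∘tabulate f x) (Equivalence.to T-≡ fx)))

≢⇒≡⁻¹ : ∀ {p q : Parity} → p ≢ q → p ≡ q ⁻¹
≢⇒≡⁻¹ {0ℙ} {0ℙ} p≢q = ⊥-elim (p≢q refl)
≢⇒≡⁻¹ {0ℙ} {1ℙ} _   = refl
≢⇒≡⁻¹ {1ℙ} {0ℙ} _   = refl
≢⇒≡⁻¹ {1ℙ} {1ℙ} p≢q = ⊥-elim (p≢q refl)

module FromGoodCoPath {n} (R : SimpleGraph n) (W : Subset n) {ps : List (List (Fin n))}
  (unique : Unique (concat ps))
  (members : ∀ x → x ∈ W ⇔ x ∈ₗ concat ps)
  (coEdges : ∀ x y → x ∈ W → y ∈ W →
     CoEdge R x y ⇔ (Σ (List (Fin n)) λ p → p ∈ₗ ps × (Consec p x y ⊎ Consec p y x)))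
  {g : ℕ → ℕ → Bool} {part : ℕ → Parity} (good : GoodCoPath (length (concat ps)) g part) where

  open GoodCoPath good

  L : List (Fin n)
  L = concat ps

  pos : Fin n → ℕ
  pos = position L

  ∈W⇒∈L : ∀ {x} → x ∈ W → x ∈ₗ L
  ∈W⇒∈L = Equivalence.to (members _)

  ∈L⇒∈W : ∀ {x} → x ∈ₗ L → x ∈ W
  ∈L⇒∈W = Equivalence.from (members _)

  next : ∀ {p x y} → p ∈ₗ ps → Consec p x y → pos y ≡ suc (pos x)
  next p∈ps = position-consec unique ∘ consec-concat p∈ps

  far⇒edge : ∀ {x y} → x ∈ₗ L → y ∈ₗ L → Far (pos x) (pos y) → Edge R x y
  far⇒edge {x} {y} x∈L y∈L far with T? (adj R x y)
  ... | yes edge = edge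
  ... | no ¬edge with Equivalence.to (coEdges x y (∈L⇒∈W x∈L) (∈L⇒∈W y∈L))
                                     ((λ { refl → ¬Far-refl _ far }) , ¬edge)
  ...   | p , p∈ps , inj₁ xy = ⊥-elim (¬Far-suc _ (subst (Far (pos x)) (next p∈ps xy) far))
  ...   | p , p∈ps , inj₂ yx = ⊥-elim (¬Far-suc _ (subst (Far (pos y)) (next p∈ps yx) (Far-sym far)))

  O : Fin n → Fin n → Bool
  O x y = ⌊ x ∈? W ×-dec y ∈? W ×-dec T? (adj R x y) ×-dec T? (tournament g (pos x) (pos y)) ⌋

  arc : ∀ {x y} → x ∈ W → y ∈ W → Edge R x y → T (tournament g (pos x) (pos y)) → Arc O x y
  arc x∈W y∈W edge x→y = fromWitness (x∈W , y∈W , edge , x→y)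

  arc-tournament : ∀ {x y} → Arc O x y → T (tournament g (pos x) (pos y))
  arc-tournament x→y = proj₂ (proj₂ (proj₂ (toWitness x→y)))

  farArc⇒arc : ∀ {x y} → x ∈ₗ L → y ∈ₗ L → FarArc g (pos x) (pos y) → Arc O x y
  farArc⇒arc x∈L y∈L (x→y , far) = arc (∈L⇒∈W x∈L) (∈L⇒∈W y∈L) (far⇒edge x∈L y∈L far) x→y

  edge⇒pos≢ : ∀ {x y} → x ∈ W → y ∈ W → Edge R x y → pos x ≢ pos y
  edge⇒pos≢ {x} {y} x∈W y∈W edge same = subst T (irrefl R y)
    (subst (λ z → Edge R z y) (position-injective (∈W⇒∈L x∈W) (∈W⇒∈L y∈W) same) edge)

  orientation : IsOrientation R W O
  orientation =
    (λ x y x→y → let x∈W , y∈W , edge , _ = toWitness x→y in x∈W , y∈W , edge) , orient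
    where
    orient : ∀ x y → x ∈ W → y ∈ W → Edge R x y →
             (Arc O x y × ¬ Arc O y x) ⊎ (Arc O y x × ¬ Arc O x y)
    orient x y x∈W y∈W edge with tournament-total g (edge⇒pos≢ x∈W y∈W edge)
    ... | inj₁ x→y = inj₁ (arc x∈W y∈W edge x→y , tournament-asym g x≢y x→y ∘ arc-tournament)
      where
      x≢y : pos x ≢ pos y
      x≢y = edge⇒pos≢ x∈W y∈W edge
    ... | inj₂ y→x = inj₂ (arc y∈W x∈W edge′ y→x , tournament-asym g y≢x y→x ∘ arc-tournament)
      where
      edge′ : Edge R y x
      edge′ = subst T (SimpleGraph.sym R x y) edge
      y≢x : pos y ≢ pos x
      y≢x = edge⇒pos≢ y∈W x∈W edge′

  Class : Parity → Subset n
  Class p = tabulate λ x → ⌊ x ∈? W ×-dec part (pos x) ℙ.≟ p ⌋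

  ∈Class⇒ : ∀ {p x} → x ∈ Class p → x ∈ₗ L × part (pos x) ≡ p
  ∈Class⇒ {p} {x} x∈p =
    let x∈W , px = toWitness (Equivalence.to (∈-tabulate _ x) x∈p) in ∈W⇒∈L x∈W , px

  ∈Class⇐ : ∀ {p x} → x ∈ₗ L → part (pos x) ≡ p → x ∈ Class p
  ∈Class⇐ {p} {x} x∈L px = Equivalence.from (∈-tabulate _ x) (fromWitness (∈L⇒∈W x∈L , px))

  Class⊆W : ∀ {p x} → x ∈ Class p → x ∈ W
  Class⊆W = ∈L⇒∈W ∘ proj₁ ∘ ∈Class⇒

  partition : IsPartition W (Class 0ℙ) (Class 1ℙ)
  partition x = mk⇔ split [ Class⊆W , Class⊆W ] , disjoint
    where
    split : x ∈ W → x ∈ Class 0ℙ ⊎ x ∈ Class 1ℙ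
    split x∈W with part (pos x) in px
    ... | 0ℙ = inj₁ (∈Class⇐ (∈W⇒∈L x∈W) px)
    ... | 1ℙ = inj₂ (∈Class⇐ (∈W⇒∈L x∈W) px)
    disjoint : ¬ (x ∈ Class 0ℙ × x ∈ Class 1ℙ)
    disjoint (x∈0 , x∈1) with trans (sym (proj₂ (∈Class⇒ x∈0))) (proj₂ (∈Class⇒ x∈1))
    ... | ()

  vertexAt : ∀ {k} → k < length L → ∃ λ z → z ∈ₗ L × pos z ≡ k
  vertexAt = position-surjective unique

  reach⇒dist : ∀ {x y} → x ∈ₗ L → y ∈ₗ L →
               Reach≤2 g (length L) (pos x) (pos y) → Dist≤2 O x y
  reach⇒dist x∈L y∈L (inj₁ same)        = inj₁ (position-injective x∈L y∈L same)
  reach⇒dist x∈L y∈L (inj₂ (inj₁ x→y)) = inj₂ (inj₁ (farArc⇒arc x∈L y∈L x→y))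
  reach⇒dist x∈L y∈L (inj₂ (inj₂ (k , k< , x→k , k→y))) with vertexAt k<
  ... | z , z∈L , refl = inj₂ (inj₂ (z , farArc⇒arc x∈L z∈L x→k , farArc⇒arc z∈L y∈L k→y))

  within : ∀ {p} x y → x ∈ Class p → y ∈ Class p → Dist≤2 O x y
  within x y x∈p y∈p with ∈Class⇒ x∈p | ∈Class⇒ y∈p
  ... | x∈L , px | y∈L , py =
    reach⇒dist x∈L y∈L (close (position-< x∈L) (position-< y∈L) (trans px (sym py)))

  across : ∀ {p} x → x ∈ Class p →
           (∃ λ v → v ∈ Class (p ⁻¹) × Arc O v x) × (∃ λ v → v ∈ Class (p ⁻¹) × Arc O x v)
  across x x∈p with ∈Class⇒ x∈p
  ... | x∈L , refl with in-across (position-< x∈L) | out-across (position-< x∈L)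
  ...   | k , k< , k≢ , k→x | l , l< , l≢ , x→l with vertexAt k< | vertexAt l<
  ...     | u , u∈L , refl | v , v∈L , refl =
            (u , ∈Class⇐ u∈L (≢⇒≡⁻¹ k≢) , farArc⇒arc u∈L x∈L k→x)
          , (v , ∈Class⇐ v∈L (≢⇒≡⁻¹ l≢) , farArc⇒arc x∈L v∈L x→l)

  nonTrivialGood : HasNonTrivialGoodOrientation R W
  nonTrivialGood = O , orientation , Class 0ℙ , Class 1ℙ , partition , within , within , across , across

corollary1 : ∀ (n : ℕ) (R : SimpleGraph n) (W : Subset n) (a b : ℕ) →
    3 ≤ a → a ≤ b → b ≤ 2 * a →
    (Σ (List (List (Fin n))) λ psX → Σ (List (List (Fin n))) λ psY →
       IsPathDecomposition R W (psX ++ psY)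
       × length (concat psX) ≡ a
       × length (concat psY) ≡ b) →
    HasNonTrivialGoodOrientation R W
corollary1 n R W a b 3≤a a≤b _ (psX , psY , (_ , unique , members , coEdges) , |X|≡a , |Y|≡b) =
  let _ , _ , good = goodCoPath _ 6≤|W| in FromGoodCoPath.nonTrivialGood R W unique members coEdges good
  where
  open ≤-Reasoning
  6≤|W| : 6 ≤ length (concat (psX ++ psY))
  6≤|W| = begin
    6                                         ≤⟨ +-mono-≤ 3≤a (≤-trans 3≤a a≤b) ⟩
    a + b                                     ≡⟨ sym (cong₂ _+_ |X|≡a |Y|≡b) ⟩
    length (concat psX) + length (concat psY) ≡⟨ sym (length-++ (concat psX)) ⟩
    length (concat psX ++ concat psY)         ≡⟨ cong length (concat-++ psX psY) ⟩
    length (concat (psX ++ psY))              ∎
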